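{- (Cut admissibility.) Let $\Gamma$ be a hypothetical context and $U$ a succedent, both suspension-normal. Then: (1) if $\Gamma\vdash[A^+]$ and $\Gamma;A^+,\Omega\vdash U$ are derivable, then $\Gamma;\Omega\vdash U$ is derivable; (2) if $\Gamma;\cdot\vdash A^-$ and $\Gamma;[A^-]\vdash U$ are derivable and $U$ is stable, then $\Gamma;\cdot\vdash U$ is derivable; (3) if $\Gamma;\cdot\vdash A^-$ and $\Gamma,A^-;L\vdash U$ are derivable, then $\Gamma;L\vdash U$ is derivable; (4) if $\Gamma;L\vdash A^+$ and $\Gamma;A^+\vdash U$ are derivable and $U$ is stable, then $\Gamma;L\vdash U$ is derivable.
   Context: Polarized propositions (each atom has a fixed polarity): $A^+ ::= p^+ \mid {\downarrow}A^- \mid \bot \mid A^+\vee B^+ \mid \top^+ \mid A^+\wedge^+ B^+$; $A^- ::= p^- \mid {\uparrow}A^+ \mid A^+\supset B^- \mid \top^- \mid A^-\wedge^- B^-$. Hypothetical contexts (multisets): $\Gamma ::= \cdot \mid \Gamma,A^- \mid \Gamma,\langle A^+\rangle$ (the latter a suspended positive proposition). Inversion contexts $\Omega$: ordered sequences of positive propositions ($\cdot$ empty, comma is append). Antecedents $L ::= \Omega \mid [A^-]$. Succedents $U ::= [A^+] \mid A^+ \mid A^- \mid \langle A^-\rangle$. $U$ is stable iff it is of the form $A^+$ (unbracketed) or $\langle A^-\rangle$. Sequents $\Gamma;L\vdash U$ come in three forms: right focus $\Gamma\vdash[A^+]$ (i.e. $L=\cdot$, $U=[A^+]$); inversion $\Gamma;\Omega\vdash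 U$ with $U$ not of the form $[A^+]$; left focus $\Gamma;[A^-]\vdash U$ with $U$ stable. Rules. Right focus: $id^+$: $\Gamma,\langle A^+\rangle\vdash[A^+]$; ${\downarrow}_R$: from $\Gamma;\cdot\vdash A^-$ infer $\Gamma\vdash[{\downarrow}A^-]$; $\vee_{R1}$/$\vee_{R2}$: from $\Gamma\vdash[A^+]$ (resp. $[B^+]$) infer $\Gamma\vdash[A^+\vee B^+]$; $\top^+_R$: $\Gamma\vdash[\top^+]$; $\wedge^+_R$: from $\Gamma\vdash[A^+]$, $\Gamma\vdash[B^+]$ infer $\Gamma\vdash[A^+\wedge^+B^+]$. Inversion: $foc_R$: from $\Gamma\vdash[A^+]$ infer $\Gamma;\cdot\vdash A^+$; $foc_L$: from $\Gamma,A^-;[A^-]\vdash U$ with $U$ stable infer $\Gamma,A^-;\cdot\vdash U$; $\eta^+$: from $\Gamma,\langle p^+\rangle;\Omega\vdash U$ infer $\Gamma;p^+,\Omega\vdash U$; ${\downarrow}_L$: from $\Gamma,A^-;\Omega\vdash U$ infer $\Gamma;{\downarrow}A^-,\Omega\vdash U$; $\bot_L$: $\Gamma;\bot,\Omega\vdash U$; $\vee_L$: from $\Gamma;A^+,\Omega\vdash U$ and $\Gamma;B^+,\Omega\vdash U$ infer $\Gamma;A^+\vee B^+,\Omega\vdash U$; $\top^+_L$: from $\Gamma;\Omega\vdash U$ infer $\Gamma;\top^+,\Omega\vdash U$; $\wedge^+_L$: from $\Gamma;A^+,B^+,\Omega\vdash U$ infer $\Gamma;A^+\wedge^+B^+,\Omega\vdash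 U$; $\eta^-$: from $\Gamma;\cdot\vdash\langle p^-\rangle$ infer $\Gamma;\cdot\vdash p^-$; ${\uparrow}_R$: from $\Gamma;\cdot\vdash A^+$ infer $\Gamma;\cdot\vdash{\uparrow}A^+$; $\supset_R$: from $\Gamma;A^+\vdash B^-$ infer $\Gamma;\cdot\vdash A^+\supset B^-$; $\top^-_R$: $\Gamma;\cdot\vdash\top^-$; $\wedge^-_R$: from $\Gamma;\cdot\vdash A^-$ and $\Gamma;\cdot\vdash B^-$ infer $\Gamma;\cdot\vdash A^-\wedge^-B^-$. Left focus ($U$ stable): $id^-$: $\Gamma;[A^-]\vdash\langle A^-\rangle$; ${\uparrow}_L$: from $\Gamma;A^+\vdash U$ infer $\Gamma;[{\uparrow}A^+]\vdash U$; $\supset_L$: from $\Gamma\vdash[A^+]$ and $\Gamma;[B^-]\vdash U$ infer $\Gamma;[A^+\supset B^-]\vdash U$; $\wedge^-_{L1}$/$\wedge^-_{L2}$: from $\Gamma;[A^-]\vdash U$ (resp. $[B^-]$) infer $\Gamma;[A^-\wedge^-B^-]\vdash U$. (No $\bot_R$, no $\top^-_L$.) A context or succedent is suspension-normal if every suspended proposition $\langle A^+\rangle$ or $\langle A^-\rangle$ in it is atomic. -}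

module Defs where

open import Data.Nat using (ℕ)
open import Data.List using (List; []; _∷_)
open import Data.List.Membership.Propositional using (_∈_)
open import Data.List.Relation.Unary.All using (All)

-- Atoms: positive atoms p⁺ and negative atoms p⁻ are drawn from two
-- disjoint countable supplies (each atom has a fixed polarity).
mutual
  data Pos : Set where
    patom : ℕ → Pos
    ↓_    : Neg → Pos
    ⊥⁺    : Pos
    _∨_   : Pos → Pos → Pos
    ⊤⁺    : Pos
    _∧⁺_  : Pos → Pos → Pos

  data Neg : Set where
    natom : ℕ → Neg
    ↑_    : Pos → Neg
    _⊃_   : Pos → Neg → Neg
    ⊤⁻    : Neg
    _∧⁻_  : Neg → Neg → Neg

-- Hypotheses: A⁻ or a suspended positive ⟨A⁺⟩.
data Hyp : Set where
  hneg  : Neg → Hyp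
  hsusp : Pos → Hyp

-- Hypothetical contexts (multisets, represented as lists; the rules only
-- consult membership and extension, so derivability is order-insensitive).
Ctx : Set
Ctx = List Hyp

InvCtx : Set
InvCtx = List Pos

-- Antecedents L ::= Ω | [A⁻]
data Ante : Set where
  inv  : InvCtx → Ante
  lfoc : Neg → Ante

-- Succedents U ::= [A⁺] | A⁺ | A⁻ | ⟨A⁻⟩
data Succ : Set where
  rfoc : Pos → Succ
  pos  : Pos → Succ
  neg  : Neg → Succ
  susp : Neg → Succ

data Stable : Succ → Set where
  st-pos  : ∀ {A} → Stable (pos A)
  st-susp : ∀ {A} → Stable (susp A)

data NotRFoc : Succ → Set where
  nr-pos  : ∀ {A} → NotRFoc (pos A)
  nr-neg  : ∀ {A} → NotRFoc (neg A)
  nr-susp : ∀ {A} → NotRFoc (susp A)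

infix 4 _︔_⊢_

-- Sequents Γ ; L ⊢ U.  Right focus Γ ⊢ [A⁺] is  Γ ︔ inv [] ⊢ rfoc A.
data _︔_⊢_ : Ctx → Ante → Succ → Set where
  id⁺  : ∀ {Γ A} → hsusp A ∈ Γ → Γ ︔ inv [] ⊢ rfoc A
  ↓R   : ∀ {Γ A} → Γ ︔ inv [] ⊢ neg A → Γ ︔ inv [] ⊢ rfoc (↓ A)
  ∨R1  : ∀ {Γ A B} → Γ ︔ inv [] ⊢ rfoc A → Γ ︔ inv [] ⊢ rfoc (A ∨ B)
  ∨R2  : ∀ {Γ A B} → Γ ︔ inv [] ⊢ rfoc B → Γ ︔ inv [] ⊢ rfoc (A ∨ B)
  ⊤⁺R  : ∀ {Γ} → Γ ︔ inv [] ⊢ rfoc ⊤⁺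
  ∧⁺R  : ∀ {Γ A B} → Γ ︔ inv [] ⊢ rfoc A → Γ ︔ inv [] ⊢ rfoc B
         → Γ ︔ inv [] ⊢ rfoc (A ∧⁺ B)
  focR : ∀ {Γ A} → Γ ︔ inv [] ⊢ rfoc A → Γ ︔ inv [] ⊢ pos A
  focL : ∀ {Γ A U} → Stable U → hneg A ∈ Γ → Γ ︔ lfoc A ⊢ U → Γ ︔ inv [] ⊢ U
  η⁺   : ∀ {Γ p Ω U} → NotRFoc U → hsusp (patom p) ∷ Γ ︔ inv Ω ⊢ U
         → Γ ︔ inv (patom p ∷ Ω) ⊢ U
  ↓L   : ∀ {Γ A Ω U} → NotRFoc U → hneg A ∷ Γ ︔ inv Ω ⊢ U
         → Γ ︔ inv (↓ A ∷ Ω) ⊢ U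
  ⊥L   : ∀ {Γ Ω U} → NotRFoc U → Γ ︔ inv (⊥⁺ ∷ Ω) ⊢ U
  ∨L   : ∀ {Γ A B Ω U} → NotRFoc U → Γ ︔ inv (A ∷ Ω) ⊢ U → Γ ︔ inv (B ∷ Ω) ⊢ U
         → Γ ︔ inv (A ∨ B ∷ Ω) ⊢ U
  ⊤⁺L  : ∀ {Γ Ω U} → NotRFoc U → Γ ︔ inv Ω ⊢ U → Γ ︔ inv (⊤⁺ ∷ Ω) ⊢ U
  ∧⁺L  : ∀ {Γ A B Ω U} → NotRFoc U → Γ ︔ inv (A ∷ B ∷ Ω) ⊢ U
         → Γ ︔ inv (A ∧⁺ B ∷ Ω) ⊢ U
  η⁻   : ∀ {Γ p} → Γ ︔ inv [] ⊢ susp (natom p) → Γ ︔ inv [] ⊢ neg (natom p)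
  ↑R   : ∀ {Γ A} → Γ ︔ inv [] ⊢ pos A → Γ ︔ inv [] ⊢ neg (↑ A)
  ⊃R   : ∀ {Γ A B} → Γ ︔ inv (A ∷ []) ⊢ neg B → Γ ︔ inv [] ⊢ neg (A ⊃ B)
  ⊤⁻R  : ∀ {Γ} → Γ ︔ inv [] ⊢ neg ⊤⁻
  ∧⁻R  : ∀ {Γ A B} → Γ ︔ inv [] ⊢ neg A → Γ ︔ inv [] ⊢ neg B
         → Γ ︔ inv [] ⊢ neg (A ∧⁻ B)
  id⁻  : ∀ {Γ A} → Γ ︔ lfoc A ⊢ susp A
  ↑L   : ∀ {Γ A U} → Stable U → Γ ︔ inv (A ∷ []) ⊢ U → Γ ︔ lfoc (↑ A) ⊢ U
  ⊃L   : ∀ {Γ A B U} → Stable U → Γ ︔ inv [] ⊢ rfoc A → Γ ︔ lfoc B ⊢ U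
         → Γ ︔ lfoc (A ⊃ B) ⊢ U
  ∧⁻L1 : ∀ {Γ A B U} → Stable U → Γ ︔ lfoc A ⊢ U → Γ ︔ lfoc (A ∧⁻ B) ⊢ U
  ∧⁻L2 : ∀ {Γ A B U} → Stable U → Γ ︔ lfoc B ⊢ U → Γ ︔ lfoc (A ∧⁻ B) ⊢ U

data SNHyp : Hyp → Set where
  sn-neg  : ∀ {A} → SNHyp (hneg A)
  sn-susp : ∀ {p} → SNHyp (hsusp (patom p))

SNCtx : Ctx → Set
SNCtx Γ = All SNHyp Γ

data SNSucc : Succ → Set where
  sn-rfoc : ∀ {A} → SNSucc (rfoc A)
  sn-pos  : ∀ {A} → SNSucc (pos A)
  sn-neg  : ∀ {A} → SNSucc (neg A)
  sn-susp : ∀ {p} → SNSucc (susp (natom p))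

module Submission where

-- The four cut principles are proved simultaneously, by a lexicographic
-- induction on the cut formula and then on one of the two derivations:
--   * cut-rfoc (1) and cut-lfoc (2) are the principal cuts: both premises end
--     with the rule that introduces the cut formula, so the cut is reduced to
--     cuts on immediate subformulas.  The only non-principal premises are the
--     identity rules id⁺ and id⁻, and suspension-normality makes them atomic.
--   * cut-hyp (3) substitutes a proof of A⁻ for the hypothesis A⁻ by induction
--     on the derivation that uses it; at each use (focL on A⁻) it calls cut-lfoc.
--   * cut-pos (4) commutes the cut past the inversion and left-focus rules of
--     the first derivation until that derivation ends in focR, where cut-rfoc
--     applies.
-- Each mutual call either shrinks the cut formula or keeps it and recurses on
-- a subderivation.

open import Defs
open import Data.List using ([]; _∷_)
open import Data.Product using (_×_; _,_)
open import Data.List.Relation.Unary.Any using (here; there)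
open import Data.List.Relation.Unary.All using (lookup; _∷_)
open import Data.List.Relation.Binary.Subset.Propositional using (_⊆_)
open import Data.List.Relation.Binary.Subset.Propositional.Properties
  using (⊆-refl; ⊆-trans; xs⊆x∷xs; ∷⁺ʳ; ∈-∷⁺ʳ)
open import Relation.Binary.PropositionalEquality using (refl)

-- Weakening (and contraction/exchange): a derivation remains valid in any
-- context containing every hypothesis of the original one.
weaken : ∀ {Γ Δ L U} → Γ ⊆ Δ → Γ ︔ L ⊢ U → Δ ︔ L ⊢ U
weaken ρ (id⁺ m)          = id⁺ (ρ m)
weaken ρ (↓R D)           = ↓R (weaken ρ D)
weaken ρ (∨R1 D)          = ∨R1 (weaken ρ D)
weaken ρ (∨R2 D)          = ∨R2 (weaken ρ D)
weaken ρ ⊤⁺R              = ⊤⁺R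
weaken ρ (∧⁺R D E)        = ∧⁺R (weaken ρ D) (weaken ρ E)
weaken ρ (focR D)         = focR (weaken ρ D)
weaken ρ (focL st m D)    = focL st (ρ m) (weaken ρ D)
weaken ρ (η⁺ nr D)        = η⁺ nr (weaken (∷⁺ʳ _ ρ) D)
weaken ρ (↓L nr D)        = ↓L nr (weaken (∷⁺ʳ _ ρ) D)
weaken ρ (⊥L nr)          = ⊥L nr
weaken ρ (∨L nr D E)      = ∨L nr (weaken ρ D) (weaken ρ E)
weaken ρ (⊤⁺L nr D)       = ⊤⁺L nr (weaken ρ D)
weaken ρ (∧⁺L nr D)       = ∧⁺L nr (weaken ρ D)
weaken ρ (η⁻ D)           = η⁻ (weaken ρ D)
weaken ρ (↑R D)           = ↑R (weaken ρ D)
weaken ρ (⊃R D)           = ⊃R (weaken ρ D)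
weaken ρ ⊤⁻R              = ⊤⁻R
weaken ρ (∧⁻R D E)        = ∧⁻R (weaken ρ D) (weaken ρ E)
weaken ρ id⁻              = id⁻
weaken ρ (↑L st D)        = ↑L st (weaken ρ D)
weaken ρ (⊃L st D E)      = ⊃L st (weaken ρ D) (weaken ρ E)
weaken ρ (∧⁻L1 st D)      = ∧⁻L1 st (weaken ρ D)
weaken ρ (∧⁻L2 st D)      = ∧⁻L2 st (weaken ρ D)

weaken-head : ∀ {h Γ L U} → Γ ︔ L ⊢ U → h ∷ Γ ︔ L ⊢ U
weaken-head {h} {Γ} = weaken (xs⊆x∷xs Γ h)

stable⇒notRFoc : ∀ {U} → Stable U → NotRFoc U
stable⇒notRFoc st-pos  = nr-pos
stable⇒notRFoc st-susp = nr-susp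

-- The invariant of cut-hyp: every hypothesis of Δ is either the cut
-- hypothesis A⁻ or a hypothesis of Γ.  It is preserved when the same
-- hypothesis is added to both contexts (as the rules η⁺ and ↓L do).
extend : ∀ {h Δ Γ A} → Δ ⊆ hneg A ∷ Γ → h ∷ Δ ⊆ hneg A ∷ h ∷ Γ
extend {h} {Γ = Γ} {A} ρ =
  ∈-∷⁺ʳ (there (here refl)) (⊆-trans ρ (∷⁺ʳ (hneg A) (xs⊆x∷xs Γ h)))

mutual
  -- (1) Principal positive cut.  A right focus from an identity uses a
  -- suspension in Γ, which is atomic, so the left premise ends in η⁺ and the
  -- cut merely discards a duplicated suspension.
  cut-rfoc : ∀ A {Γ Ω U} → SNCtx Γ → SNSucc U
           → Γ ︔ inv [] ⊢ rfoc A → Γ ︔ inv (A ∷ Ω) ⊢ U → Γ ︔ inv Ω ⊢ U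
  cut-rfoc A sn su (id⁺ m) E with lookup sn m
  cut-rfoc A sn su (id⁺ m) (η⁺ _ E) | sn-susp = weaken (∈-∷⁺ʳ m ⊆-refl) E
  cut-rfoc (↓ A) sn su (↓R D) (↓L _ E) = cut-hyp A sn su D ⊆-refl E
  cut-rfoc (A ∨ B) sn su (∨R1 D) (∨L _ E₁ E₂) = cut-rfoc A sn su D E₁
  cut-rfoc (A ∨ B) sn su (∨R2 D) (∨L _ E₁ E₂) = cut-rfoc B sn su D E₂
  cut-rfoc ⊤⁺ sn su ⊤⁺R (⊤⁺L _ E) = E
  cut-rfoc (A ∧⁺ B) sn su (∧⁺R D₁ D₂) (∧⁺L _ E) =
    cut-rfoc B sn su D₂ (cut-rfoc A sn su D₁ E)

  -- A proof of A⁻ ends in its right rule (focL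
  -- would need a stable succedent).  Against id⁻ the succedent ⟨A⁻⟩ is
  -- atomic, so the proof of p⁻ ends in η⁻; in particular ⊤⁻, which has no
  -- left rule, cannot be focused on.
  cut-lfoc : ∀ A {Γ U} → SNCtx Γ → SNSucc U
           → Γ ︔ inv [] ⊢ neg A → Γ ︔ lfoc A ⊢ U → Γ ︔ inv [] ⊢ U
  cut-lfoc A sn su (focL () _ _) E
  cut-lfoc (natom p) sn sn-susp (η⁻ D) id⁻ = D
  cut-lfoc ⊤⁻ sn () ⊤⁻R id⁻
  cut-lfoc (↑ A) sn su (↑R D) (↑L st E) = cut-pos A sn su D E st
  cut-lfoc (A ⊃ B) sn su (⊃R D) (⊃L _ E₁ E₂) =
    cut-lfoc B sn su (cut-rfoc A sn sn-neg E₁ D) E₂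
  cut-lfoc (A ∧⁻ B) sn su (∧⁻R D₁ D₂) (∧⁻L1 _ E) = cut-lfoc A sn su D₁ E
  cut-lfoc (A ∧⁻ B) sn su (∧⁻R D₁ D₂) (∧⁻L2 _ E) = cut-lfoc B sn su D₂ E

  -- The context Δ of the second
  -- derivation is only required to embed into A⁻ ∷ Γ: this generalisation
  -- keeps the induction structural when rules below add hypotheses in front
  -- of the cut hypothesis.
  cut-hyp : ∀ A {Γ Δ L U} → SNCtx Γ → SNSucc U → Γ ︔ inv [] ⊢ neg A
          → Δ ⊆ hneg A ∷ Γ → Δ ︔ L ⊢ U → Γ ︔ L ⊢ U
  cut-hyp A sn su F ρ (id⁺ m) with ρ m
  ... | here ()
  ... | there m′ = id⁺ m′
  cut-hyp A sn su F ρ (focL st m E) with ρ m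
  ... | here refl = cut-lfoc A sn su F (cut-hyp A sn su F ρ E)
  ... | there m′  = focL st m′ (cut-hyp A sn su F ρ E)
  cut-hyp A sn su F ρ (↓R E)        = ↓R (cut-hyp A sn sn-neg F ρ E)
  cut-hyp A sn su F ρ (∨R1 E)       = ∨R1 (cut-hyp A sn sn-rfoc F ρ E)
  cut-hyp A sn su F ρ (∨R2 E)       = ∨R2 (cut-hyp A sn sn-rfoc F ρ E)
  cut-hyp A sn su F ρ ⊤⁺R           = ⊤⁺R
  cut-hyp A sn su F ρ (∧⁺R E₁ E₂)   =
    ∧⁺R (cut-hyp A sn sn-rfoc F ρ E₁) (cut-hyp A sn sn-rfoc F ρ E₂)
  cut-hyp A sn su F ρ (focR E)      = focR (cut-hyp A sn sn-rfoc F ρ E)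
  cut-hyp A sn su F ρ (η⁺ nr E)     =
    η⁺ nr (cut-hyp A (sn-susp ∷ sn) su (weaken-head F) (extend ρ) E)
  cut-hyp A sn su F ρ (↓L nr E)     =
    ↓L nr (cut-hyp A (sn-neg ∷ sn) su (weaken-head F) (extend ρ) E)
  cut-hyp A sn su F ρ (⊥L nr)       = ⊥L nr
  cut-hyp A sn su F ρ (∨L nr E₁ E₂) = ∨L nr (cut-hyp A sn su F ρ E₁) (cut-hyp A sn su F ρ E₂)
  cut-hyp A sn su F ρ (⊤⁺L nr E)    = ⊤⁺L nr (cut-hyp A sn su F ρ E)
  cut-hyp A sn su F ρ (∧⁺L nr E)    = ∧⁺L nr (cut-hyp A sn su F ρ E)
  cut-hyp A sn su F ρ (η⁻ E)        = η⁻ (cut-hyp A sn sn-susp F ρ E)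
  cut-hyp A sn su F ρ (↑R E)        = ↑R (cut-hyp A sn sn-pos F ρ E)
  cut-hyp A sn su F ρ (⊃R E)        = ⊃R (cut-hyp A sn sn-neg F ρ E)
  cut-hyp A sn su F ρ ⊤⁻R           = ⊤⁻R
  cut-hyp A sn su F ρ (∧⁻R E₁ E₂)   =
    ∧⁻R (cut-hyp A sn sn-neg F ρ E₁) (cut-hyp A sn sn-neg F ρ E₂)
  cut-hyp A sn su F ρ id⁻           = id⁻
  cut-hyp A sn su F ρ (↑L st E)     = ↑L st (cut-hyp A sn su F ρ E)
  cut-hyp A sn su F ρ (⊃L st E₁ E₂) = ⊃L st (cut-hyp A sn sn-rfoc F ρ E₁) (cut-hyp A sn su F ρ E₂)
  cut-hyp A sn su F ρ (∧⁻L1 st E)   = ∧⁻L1 st (cut-hyp A sn su F ρ E)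
  cut-hyp A sn su F ρ (∧⁻L2 st E)   = ∧⁻L2 st (cut-hyp A sn su F ρ E)

  -- (4) Cut against a proof of the stable succedent A⁺: every rule of the
  -- first derivation other than focR has a premise with the same succedent,
  -- so the cut is pushed into that premise; at focR it becomes principal.
  cut-pos : ∀ A {Γ L U} → SNCtx Γ → SNSucc U → Γ ︔ L ⊢ pos A
          → Γ ︔ inv (A ∷ []) ⊢ U → Stable U → Γ ︔ L ⊢ U
  cut-pos A sn su (focR D) E st       = cut-rfoc A sn su D E
  cut-pos A sn su (focL _ m D) E st   = focL st m (cut-pos A sn su D E st)
  cut-pos A sn su (η⁺ _ D) E st       =
    η⁺ (stable⇒notRFoc st) (cut-pos A (sn-susp ∷ sn) su D (weaken-head E) st)
  cut-pos A sn su (↓L _ D) E st       =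
    ↓L (stable⇒notRFoc st) (cut-pos A (sn-neg ∷ sn) su D (weaken-head E) st)
  cut-pos A sn su (⊥L _) E st         = ⊥L (stable⇒notRFoc st)
  cut-pos A sn su (∨L _ D₁ D₂) E st   =
    ∨L (stable⇒notRFoc st) (cut-pos A sn su D₁ E st) (cut-pos A sn su D₂ E st)
  cut-pos A sn su (⊤⁺L _ D) E st      = ⊤⁺L (stable⇒notRFoc st) (cut-pos A sn su D E st)
  cut-pos A sn su (∧⁺L _ D) E st      = ∧⁺L (stable⇒notRFoc st) (cut-pos A sn su D E st)
  cut-pos A sn su (↑L _ D) E st       = ↑L st (cut-pos A sn su D E st)
  cut-pos A sn su (⊃L _ D₁ D₂) E st   = ⊃L st D₁ (cut-pos A sn su D₂ E st)
  cut-pos A sn su (∧⁻L1 _ D) E st     = ∧⁻L1 st (cut-pos A sn su D E st)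
  cut-pos A sn su (∧⁻L2 _ D) E st     = ∧⁻L2 st (cut-pos A sn su D E st)

theorem2 : ∀ (Γ : Ctx) (U : Succ) → SNCtx Γ → SNSucc U →
    (∀ (A : Pos) (Ω : InvCtx) → Γ ︔ inv [] ⊢ rfoc A → Γ ︔ inv (A ∷ Ω) ⊢ U
      → Γ ︔ inv Ω ⊢ U)
    × (∀ (A : Neg) → Γ ︔ inv [] ⊢ neg A → Γ ︔ lfoc A ⊢ U → Stable U
      → Γ ︔ inv [] ⊢ U)
    × (∀ (A : Neg) (L : Ante) → Γ ︔ inv [] ⊢ neg A → hneg A ∷ Γ ︔ L ⊢ U
      → Γ ︔ L ⊢ U)
    × (∀ (A : Pos) (L : Ante) → Γ ︔ L ⊢ pos A → Γ ︔ inv (A ∷ []) ⊢ U → Stable U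
      → Γ ︔ L ⊢ U)
theorem2 Γ U sn su =
    (λ A Ω D E → cut-rfoc A sn su D E)
  , (λ A D E _ → cut-lfoc A sn su D E)
  , (λ A L D E → cut-hyp A sn su D ⊆-refl E)
  , (λ A L D E st → cut-pos A sn su D E st)
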